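{- Let $m\ge 2$, $n\ge 4$, let $C$ be any maximal configuration on the $m\times n$ grid, and let $1\le l\le m$ and $1\le t\le n-3$ be integers. If $S=\{1,2,\dots,l\}\times\{t,t+1,t+2,t+3\}$, then $|C\cap S|\ge \frac{1}{2}|S|=2l$.
   Context: The $m\times n$ grid is $[m]\times[n]=\{(i,j):1\le i\le m,\ 1\le j\le n\}$; $(i,j)$ is the lot in row $i$ and column $j$, rows counted from the north (row $1$ northernmost, row $m$ southernmost) and columns from the west. A configuration is a subset $C\subseteq[m]\times[n]$ (the occupied lots). A house at $(i,j)\in C$ is blocked from sunlight if $(i,j+1)$, $(i,j-1)$, $(i+1,j)$ all lie in the grid and are all occupied (lots outside the grid never obstruct sunlight). A configuration is permissible if no house in it is blocked; it is maximal if it is permissible and no permissible configuration strictly contains it. -}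

module Defs where

open import Data.Nat using (ℕ; zero; suc; _+_; _∸_; _≤_; _<_)
open import Data.Bool using (Bool; true; false)
open import Data.Product using (_×_)
open import Relation.Nullary using (¬_)
open import Relation.Binary.PropositionalEquality using (_≡_)

-- Lots are pairs (i , j) of naturals, 1-indexed: row i (counted from the north),
-- column j (counted from the west).  Grid [m] × [n].
InGrid : ℕ → ℕ → ℕ → ℕ → Set
InGrid m n i j = (1 ≤ i × i ≤ m) × (1 ≤ j × j ≤ n)

Config : Set
Config = ℕ → ℕ → Bool

Occ : Config → ℕ → ℕ → Set
Occ C i j = C i j ≡ true

IsConfig : ℕ → ℕ → Config → Set
IsConfig m n C = ∀ i j → Occ C i j → InGrid m n i j

-- The house at (i,j) is blocked: (i,j+1), (i,j-1), (i+1,j) all lie in the grid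
-- and are all occupied.  (i,j-1) lies in the grid requires 2 ≤ j; then j-1 = j ∸ 1.
Blocked : ℕ → ℕ → Config → ℕ → ℕ → Set
Blocked m n C i j =
  (InGrid m n i (suc j) × Occ C i (suc j)) ×
  ((2 ≤ j × InGrid m n i (j ∸ 1) × Occ C i (j ∸ 1)) ×
   (InGrid m n (suc i) j × Occ C (suc i) j))

Permissible : ℕ → ℕ → Config → Set
Permissible m n C = IsConfig m n C × (∀ i j → Occ C i j → ¬ Blocked m n C i j)

_⊆C_ : Config → Config → Set
C ⊆C D = ∀ i j → Occ C i j → Occ D i j

Maximal : ℕ → ℕ → Config → Set
Maximal m n C = Permissible m n C × (∀ D → Permissible m n D → C ⊆C D → D ⊆C C)

ind : Bool → ℕ
ind true  = 1
ind false = 0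

sumFrom1 : ℕ → (ℕ → ℕ) → ℕ
sumFrom1 zero    f = 0
sumFrom1 (suc l) f = sumFrom1 l f + f (suc l)

countBlock : Config → ℕ → ℕ → ℕ
countBlock C l t =
  sumFrom1 l (λ i → ind (C i t) + ind (C i (t + 1)) + ind (C i (t + 2)) + ind (C i (t + 3)))

{-# OPTIONS --safe #-}
-- Take a row i whose four lots in the window hold at most one house.  Then one of the
-- two middle lots, say (i , j), is vacant and so are enough of its row neighbours that
-- a house added at (i , j) blocks no house of row i.  By maximality the addition must
-- block something, and the only candidate left is the house north of (i , j): row
-- i - 1 is occupied at j - 1, j and j + 1.  Using both middle lots when row i is empty,
-- rows i - 1 and i together hold at least four houses of the window.  Row 0 is empty,
-- so row 1 holds at least two, and an induction over the rows gives 2l.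
module Submission where

open import Defs
open import Data.Nat using (ℕ; zero; suc; _+_; _*_; _∸_; _≤_; _<_; z≤n; s≤s) renaming (_≟_ to _≟ℕ_)
open import Data.Nat.Properties
  using (+-comm; +-assoc; +-mono-≤; +-monoˡ-≤; ≤-trans; ≤-refl; n≤1+n; m<n⇒m<1+n; module ≤-Reasoning)
open import Data.Nat.Tactic.RingSolver using (solve-∀)
open import Data.Bool using (Bool; true; false; _∨_; _∧_; _≟_)
open import Data.Bool.Properties using (not-¬; ∨-zeroʳ)
open import Data.Product using (_×_; _,_; proj₂)
open import Data.Sum using (_⊎_; inj₁; inj₂)
open import Data.Empty using (⊥; ⊥-elim)
open import Relation.Nullary using (¬_; Dec; yes; no)
open import Relation.Nullary.Decidable using (⌊_⌋; _×-dec_; _⊎-dec_; decidable-stable)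
open import Relation.Binary.PropositionalEquality using (_≡_; refl; sym; cong₂; subst)

Vacant : Config → ℕ → ℕ → Set
Vacant C i j = C i j ≡ false

OccupiedTriple : Config → ℕ → ℕ → Set
OccupiedTriple C i j = Occ C i (j ∸ 1) × Occ C i j × Occ C i (suc j)

-- The houses whose sunlight a new house at (i , j) can take: its own, and those of
-- its west, east and north neighbours.
Threatened : Config → ℕ → ℕ → Set
Threatened C i j =
  (Occ C i (j ∸ 1) × Occ C i (suc j) × Occ C (suc i) j) ⊎
  (Occ C i (j ∸ 1) × Occ C i (j ∸ 2) × Occ C (suc i) (j ∸ 1)) ⊎
  (Occ C i (suc j) × Occ C i (suc (suc j)) × Occ C (suc i) (suc j)) ⊎
  OccupiedTriple C (i ∸ 1) j

occ? : ∀ C i j → Dec (Occ C i j)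
occ? C i j = C i j ≟ true

threatened? : ∀ C i j → Dec (Threatened C i j)
threatened? C i j =
  (occ? C i (j ∸ 1) ×-dec occ? C i (suc j) ×-dec occ? C (suc i) j) ⊎-dec
  (occ? C i (j ∸ 1) ×-dec occ? C i (j ∸ 2) ×-dec occ? C (suc i) (j ∸ 1)) ⊎-dec
  (occ? C i (suc j) ×-dec occ? C i (suc (suc j)) ×-dec occ? C (suc i) (suc j)) ⊎-dec
  (occ? C (i ∸ 1) (j ∸ 1) ×-dec occ? C (i ∸ 1) j ×-dec occ? C (i ∸ 1) (suc j))

insert : ℕ → ℕ → Config → Config
insert i j C a b = C a b ∨ (⌊ a ≟ℕ i ⌋ ∧ ⌊ b ≟ℕ j ⌋)

insert-occupies : ∀ i j C → Occ (insert i j C) i j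
insert-occupies i j C with i ≟ℕ i | j ≟ℕ j
... | yes _ | yes _ = ∨-zeroʳ (C i j)
... | no i≢i | _    = ⊥-elim (i≢i refl)
... | yes _ | no j≢j = ⊥-elim (j≢j refl)

⊆-insert : ∀ i j C → C ⊆C insert i j C
⊆-insert i j C a b occ rewrite occ = refl

insert-occ⁻ : ∀ {i j C a b} → Occ (insert i j C) a b → Occ C a b ⊎ (a ≡ i × b ≡ j)
insert-occ⁻ {i} {j} {C} {a} {b} occ with C a b | a ≟ℕ i | b ≟ℕ j | occ
... | true  | _        | _        | _ = inj₁ refl
... | false | yes refl | yes refl | _ = inj₂ (refl , refl)
... | false | no _     | _        | ()
... | false | yes _    | no _     | ()

insert-unblocked : ∀ {m n C i j} → (∀ a b → Occ C a b → ¬ Blocked m n C a b) → ¬ Threatened C i j →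
                   ∀ a b → Occ (insert i j C) a b → ¬ Blocked m n (insert i j C) a b
insert-unblocked {C = C} {i} {j} C-unblocked unthreatened a (suc (suc b)) occ
                 ((gE , oE) , ((2≤b , gW , oW) , (gS , oS)))
  with insert-occ⁻ {i} {j} {C} occ | insert-occ⁻ {i} {j} {C} oE
     | insert-occ⁻ {i} {j} {C} oW  | insert-occ⁻ {i} {j} {C} oS
... | inj₁ c | inj₁ cE | inj₁ cW | inj₁ cS =
  C-unblocked a _ c ((gE , cE) , ((2≤b , gW , cW) , (gS , cS)))
... | inj₂ (refl , refl) | inj₁ cE | inj₁ cW | inj₁ cS = unthreatened (inj₁ (cW , cE , cS))
... | inj₁ c | inj₂ (refl , refl) | inj₁ cW | inj₁ cS = unthreatened (inj₂ (inj₁ (c , cW , cS)))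
... | inj₁ c | inj₁ cE | inj₂ (refl , refl) | inj₁ cS = unthreatened (inj₂ (inj₂ (inj₁ (c , cE , cS))))
... | inj₁ c | inj₁ cE | inj₁ cW | inj₂ (refl , refl) = unthreatened (inj₂ (inj₂ (inj₂ (cW , c , cE))))
... | inj₂ (refl , refl) | inj₂ (_ , ()) | _ | _
... | inj₂ (refl , refl) | _ | inj₂ (_ , ()) | _
... | inj₂ (refl , refl) | _ | _ | inj₂ (() , _)
... | _ | inj₂ (refl , refl) | inj₂ (_ , ()) | _
... | _ | inj₂ (refl , refl) | _ | inj₂ (() , _)
... | _ | _ | inj₂ (refl , refl) | inj₂ (() , _)

insert-permissible : ∀ {m n C i j} → Permissible m n C → InGrid m n i j →
                     ¬ Threatened C i j → Permissible m n (insert i j C)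
insert-permissible {m} {n} {C} {i} {j} (C-config , C-unblocked) ij∈grid unthreatened =
  config , insert-unblocked C-unblocked unthreatened
  where
  config : IsConfig m n (insert i j C)
  config a b occ with insert-occ⁻ {i} {j} {C} occ
  ... | inj₁ occ′ = C-config a b occ′
  ... | inj₂ (refl , refl) = ij∈grid

vacant-lot-threatened : ∀ {m n C i j} → Maximal m n C → InGrid m n i j → Vacant C i j →
                        Threatened C i j
vacant-lot-threatened {C = C} {i} {j} (C-permissible , C-maximal) ij∈grid vacant =
  decidable-stable (threatened? C i j) λ unthreatened →
    not-¬ (C-maximal (insert i j C) (insert-permissible C-permissible ij∈grid unthreatened)
                     (⊆-insert i j C) i j (insert-occupies i j C))
          vacant

¬both-true : ∀ {x y : Bool} → x ≡ false ⊎ y ≡ false → x ≡ true → y ≡ true → ⊥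
¬both-true (inj₁ x≡false) x≡true _ = not-¬ x≡true x≡false
¬both-true (inj₂ y≡false) _ y≡true = not-¬ y≡true y≡false

-- A house at (i , j) would complete no run of three houses in row i centred at
-- (i , j) or at one of its row neighbours.
RowSafe : Config → ℕ → ℕ → Set
RowSafe C i j = (Vacant C i (j ∸ 1) ⊎ Vacant C i (suc j)) ×
                (Vacant C i (j ∸ 1) ⊎ Vacant C i (j ∸ 2)) ×
                (Vacant C i (suc j) ⊎ Vacant C i (suc (suc j)))

north-of-row-safe-gap : ∀ {m n C i j} → Maximal m n C → InGrid m n i j → Vacant C i j →
                        RowSafe C i j → OccupiedTriple C (i ∸ 1) j
north-of-row-safe-gap max ij∈grid vacant (safe-self , safe-west , safe-east)
  with vacant-lot-threatened max ij∈grid vacant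
... | inj₁ (w , e , _)               = ⊥-elim (¬both-true safe-self w e)
... | inj₂ (inj₁ (w , ww , _))       = ⊥-elim (¬both-true safe-west w ww)
... | inj₂ (inj₂ (inj₁ (e , ee , _))) = ⊥-elim (¬both-true safe-east e ee)
... | inj₂ (inj₂ (inj₂ north))       = north

rowCount : Config → ℕ → ℕ → ℕ
rowCount C t i =
  ind (C i t) + ind (C i (suc t)) + ind (C i (suc (suc t))) + ind (C i (suc (suc (suc t))))

rowCount-≥3ˡ : ∀ {C t i} → OccupiedTriple C i (suc t) → 3 ≤ rowCount C t i
rowCount-≥3ˡ (p , q , r) rewrite p | q | r = s≤s (s≤s (s≤s z≤n))

rowCount-≥3ʳ : ∀ {C t i} → OccupiedTriple C i (suc (suc t)) → 3 ≤ rowCount C t i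
rowCount-≥3ʳ {C} {t} {i} (p , q , r) rewrite p | q | r with C i t
... | true  = s≤s (s≤s (s≤s z≤n))
... | false = s≤s (s≤s (s≤s z≤n))

rowCount-≥4 : ∀ {C t i} → OccupiedTriple C i (suc t) → OccupiedTriple C i (suc (suc t)) →
              4 ≤ rowCount C t i
rowCount-≥4 (p , q , r) (_ , _ , s) rewrite p | q | r | s = s≤s (s≤s (s≤s (s≤s z≤n)))

NorthCovers : Config → ℕ → ℕ → Set
NorthCovers C a j = Vacant C (suc a) j → RowSafe C (suc a) j → OccupiedTriple C a j

rowCount-≥2-or-with-north-≥4-by :
  ∀ {C a t} → NorthCovers C a (suc t) → NorthCovers C a (suc (suc t)) →
  2 ≤ rowCount C t (suc a) ⊎ 4 ≤ rowCount C t a + rowCount C t (suc a)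
rowCount-≥2-or-with-north-≥4-by {C} {a} {t} cover₁ cover₂
  with C (suc a) t | C (suc a) (suc t) | C (suc a) (suc (suc t)) | C (suc a) (suc (suc (suc t)))
... | true  | true  | _     | _     = inj₁ (s≤s (s≤s z≤n))
... | true  | false | true  | _     = inj₁ (s≤s (s≤s z≤n))
... | true  | false | false | true  = inj₁ (s≤s (s≤s z≤n))
... | false | true  | true  | _     = inj₁ (s≤s (s≤s z≤n))
... | false | true  | false | true  = inj₁ (s≤s (s≤s z≤n))
... | false | false | true  | true  = inj₁ (s≤s (s≤s z≤n))
... | false | false | false | false =
  inj₂ (+-monoˡ-≤ 0 (rowCount-≥4 {C} {t} {a} (cover₁ refl (inj₁ refl , inj₁ refl , inj₁ refl))
                                 (cover₂ refl (inj₁ refl , inj₁ refl , inj₁ refl))))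
... | true  | false | false | false =
  inj₂ (+-monoˡ-≤ 1 (rowCount-≥3ʳ {C} {t} {a} (cover₂ refl (inj₁ refl , inj₁ refl , inj₁ refl))))
... | false | true  | false | false =
  inj₂ (+-monoˡ-≤ 1 (rowCount-≥3ʳ {C} {t} {a} (cover₂ refl (inj₂ refl , inj₂ refl , inj₁ refl))))
... | false | false | true  | false =
  inj₂ (+-monoˡ-≤ 1 (rowCount-≥3ˡ {C} {t} {a} (cover₁ refl (inj₁ refl , inj₁ refl , inj₂ refl))))
... | false | false | false | true  =
  inj₂ (+-monoˡ-≤ 1 (rowCount-≥3ˡ {C} {t} {a} (cover₁ refl (inj₁ refl , inj₁ refl , inj₁ refl))))

rowCount-≥2-or-with-north-≥4 :
  ∀ {m n C a t} → Maximal m n C → suc a ≤ m → suc (suc (suc t)) ≤ n →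
  2 ≤ rowCount C t (suc a) ⊎ 4 ≤ rowCount C t a + rowCount C t (suc a)
rowCount-≥2-or-with-north-≥4 {m} {n} {C} {a} {t} max a<m t+3≤n =
  rowCount-≥2-or-with-north-≥4-by {C} {a} {t}
    (north-of-row-safe-gap max (row∈grid , column₁∈grid))
    (north-of-row-safe-gap max (row∈grid , column₂∈grid))
  where
  row∈grid : 1 ≤ suc a × suc a ≤ m
  row∈grid = s≤s z≤n , a<m
  column₂∈grid : 1 ≤ suc (suc t) × suc (suc t) ≤ n
  column₂∈grid = s≤s z≤n , ≤-trans (n≤1+n _) t+3≤n
  column₁∈grid : 1 ≤ suc t × suc t ≤ n
  column₁∈grid = s≤s z≤n , ≤-trans (n≤1+n _) (proj₂ column₂∈grid)

open ≤-Reasoning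

double-suc : ∀ l → 2 * suc l ≡ 2 * l + 2
double-suc = solve-∀

double-suc-suc : ∀ l → 2 * suc (suc l) ≡ 2 * l + 4
double-suc-suc = solve-∀

2*l≤sumFrom1-step :
  ∀ k (f : ℕ → ℕ) → 2 * k ≤ sumFrom1 k f → 2 * suc k ≤ sumFrom1 (suc k) f →
  2 ≤ f (suc (suc k)) ⊎ 4 ≤ f (suc k) + f (suc (suc k)) →
  2 * suc (suc k) ≤ sumFrom1 (suc (suc k)) f
2*l≤sumFrom1-step k f _ ih₁ (inj₁ 2≤f) = begin
  2 * suc (suc k)                              ≡⟨ double-suc (suc k) ⟩
  2 * suc k + 2                                ≤⟨ +-mono-≤ ih₁ 2≤f ⟩
  sumFrom1 (suc (suc k)) f                     ∎
2*l≤sumFrom1-step k f ih₀ _ (inj₂ 4≤f+f) = begin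
  2 * suc (suc k)                              ≡⟨ double-suc-suc k ⟩
  2 * k + 4                                    ≤⟨ +-mono-≤ ih₀ 4≤f+f ⟩
  sumFrom1 k f + (f (suc k) + f (suc (suc k))) ≡⟨ +-assoc (sumFrom1 k f) _ _ ⟨
  sumFrom1 (suc (suc k)) f                     ∎

2*l≤sumFrom1 : ∀ l (f : ℕ → ℕ) → f 0 ≡ 0 →
                   (∀ i → i < l → 2 ≤ f (suc i) ⊎ 4 ≤ f i + f (suc i)) →
                   2 * l ≤ sumFrom1 l f
2*l≤sumFrom1 zero f f₀≡0 step = z≤n
2*l≤sumFrom1 (suc zero) f f₀≡0 step with step 0 (s≤s z≤n)
... | inj₁ 2≤f₁ = 2≤f₁
... | inj₂ 4≤f₀+f₁ rewrite f₀≡0 = ≤-trans (s≤s (s≤s z≤n)) 4≤f₀+f₁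
2*l≤sumFrom1 (suc (suc k)) f f₀≡0 step =
  2*l≤sumFrom1-step k f
    (2*l≤sumFrom1 k f f₀≡0 λ i i<k → step i (m<n⇒m<1+n (m<n⇒m<1+n i<k)))
    (2*l≤sumFrom1 (suc k) f f₀≡0 λ i i<k+1 → step i (m<n⇒m<1+n i<k+1))
    (step (suc k) ≤-refl)

row-zero-vacant : ∀ {m n C} → IsConfig m n C → ∀ j → Vacant C 0 j
row-zero-vacant {C = C} C-config j with C 0 j in occ
... | false = refl
... | true with C-config 0 j occ
...   | (() , _) , _

rowCount-zero : ∀ {m n C} → IsConfig m n C → ∀ t → rowCount C t 0 ≡ 0
rowCount-zero C-config t
  rewrite row-zero-vacant C-config t | row-zero-vacant C-config (suc t)
        | row-zero-vacant C-config (suc (suc t)) | row-zero-vacant C-config (suc (suc (suc t))) = refl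

sumFrom1-cong : ∀ l {f g : ℕ → ℕ} → (∀ i → f i ≡ g i) → sumFrom1 l f ≡ sumFrom1 l g
sumFrom1-cong zero    f≗g = refl
sumFrom1-cong (suc l) f≗g = cong₂ _+_ (sumFrom1-cong l f≗g) (f≗g (suc l))

countBlock≡sumFrom1-rowCount : ∀ C l t → countBlock C l t ≡ sumFrom1 l (rowCount C t)
countBlock≡sumFrom1-rowCount C l t = sumFrom1-cong l row
  where
  row : ∀ i → ind (C i t) + ind (C i (t + 1)) + ind (C i (t + 2)) + ind (C i (t + 3)) ≡ rowCount C t i
  row i rewrite +-comm t 1 | +-comm t 2 | +-comm t 3 = refl

-- The bound needs none of the hypotheses 2 ≤ m, 4 ≤ n, 1 ≤ l and 1 ≤ t.
lemma4p4 : (m n : ℕ) → 2 ≤ m → 4 ≤ n → (C : Config) → Maximal m n C →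
           (l t : ℕ) → 1 ≤ l → l ≤ m → 1 ≤ t → t + 3 ≤ n →
           2 * l ≤ countBlock C l t
lemma4p4 m n _ _ C max@((C-config , _) , _) l t _ l≤m _ t+3≤n =
  subst (2 * l ≤_) (sym (countBlock≡sumFrom1-rowCount C l t))
    (2*l≤sumFrom1 l (rowCount C t) (rowCount-zero C-config t)
      λ i i<l → rowCount-≥2-or-with-north-≥4 max (≤-trans i<l l≤m) 3+t≤n)
  where
  3+t≤n : 3 + t ≤ n
  3+t≤n = subst (_≤ n) (+-comm t 3) t+3≤n
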